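{- If $n < q$, then $f(n,q) = n+1$.
   Context: For integers $n \geq 1$ and $q \geq 2$, let $\mathbb Z_q = \mathbb Z/q\mathbb Z$ and consider $\mathbb Z_q^n$ with the Hamming distance $d(x,y)$ = number of coordinates in which $x$ and $y$ differ. Say $x$ skirts $y$ if $d(x,y) = n$. A set $S \subseteq \mathbb Z_q^n$ is a skirting set if every $y \in \mathbb Z_q^n$ is skirted by some $x \in S$. Let $f(n,q)$ denote the minimum size of a skirting set in $\mathbb Z_q^n$. -}

module Defs where

open import Data.Nat using (ℕ; _≤_)
open import Data.Fin using (Fin)
open import Data.List using (List; length)
open import Data.List.Membership.Propositional using (_∈_)
open import Data.List.Relation.Unary.Unique.Propositional using (Unique)
open import Data.Product using (Σ; ∃; _×_)
open import Relation.Binary.PropositionalEquality using (_≢_; _≡_)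

Word : ℕ → ℕ → Set
Word n q = Fin n → Fin q

-- x skirts y iff d(x,y) = n, i.e. x and y differ in every coordinate
Skirts : ∀ {n q} → Word n q → Word n q → Set
Skirts {n} x y = ∀ (i : Fin n) → x i ≢ y i

record FinSubset (n q : ℕ) : Set where
  constructor mkSubset
  field
    elems  : List (Word n q)
    unique : Unique elems

open FinSubset public

size : ∀ {n q} → FinSubset n q → ℕ
size S = length (elems S)

IsSkirting : ∀ {n q} → FinSubset n q → Set
IsSkirting {n} {q} S = ∀ (y : Word n q) → ∃ λ x → x ∈ elems S × Skirts x y

IsMinSkirtingSize : ℕ → ℕ → ℕ → Set
IsMinSkirtingSize n q m =
  (Σ (FinSubset n q) λ S → IsSkirting S × size S ≡ m)
  × (∀ (S : FinSubset n q) → IsSkirting S → m ≤ size S)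

module Submission where

open import Defs
open import Data.Nat using (ℕ; suc; _<_; _≤_; _<?_)
open import Data.Nat.Properties using (n<1+n; ≮⇒≥)
open import Data.Fin using (Fin; zero; toℕ; fromℕ<; inject≤; _≟_)
open import Data.Fin.Properties
  using (toℕ-injective; toℕ-fromℕ<; toℕ-inject≤; toℕ<n; inject≤-injective; pigeonhole; <⇒≢; any?; all?; ¬∀⟶∃¬)
open import Data.List using (List; length; lookup; tabulate)
open import Data.List.Properties using (length-tabulate)
open import Data.List.Membership.Propositional using (_∈_)
open import Data.List.Membership.Propositional.Properties using (∈-tabulate⁺)
open import Data.List.Relation.Unary.Any using (index)
open import Data.List.Relation.Unary.Any.Properties using (lookup-index)
open import Data.List.Relation.Unary.Unique.Propositional.Properties using (tabulate⁺)
open import Data.Product using (∃; _,_; proj₁; proj₂)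
open import Function.Definitions using (Injective)
open import Relation.Binary.Definitions using (DecidableEquality)
open import Relation.Binary.PropositionalEquality using (_≡_; _≢_; sym; trans; cong; cong-app; subst)
open import Relation.Nullary using (¬_; yes; no)
open import Relation.Nullary.Negation using (contradiction)

-- Upper bound: a word y takes at most n values, so one of the n + 1 constant
-- words 0, …, n avoids all of them and skirts y.  Lower bound: given at most n
-- words x₀, x₁, …, the word y with yᵢ = xᵢ(i) agrees with each xᵢ at
-- coordinate i, so it is skirted by none of them.

module _ {a} {A : Set a} (_≟ᴬ_ : DecidableEquality A) where

  injection-not-covered : ∀ {m n} → n < m → (f : Fin m → A) → Injective _≡_ _≡_ f →
                          (y : Fin n → A) → ¬ (∀ j → ∃ λ i → f j ≡ y i)
  injection-not-covered n<m f f-inj y covered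
    with j , k , j<k , same ← pigeonhole n<m (λ j → proj₁ (covered j))
    = <⇒≢ j<k (f-inj (trans (proj₂ (covered j)) (trans (cong y same) (sym (proj₂ (covered k))))))

  ∃-outside-image : ∀ {m n} → n < m → (f : Fin m → A) → Injective _≡_ _≡_ f →
                    (y : Fin n → A) → ∃ λ j → ∀ i → f j ≢ y i
  ∃-outside-image {m} n<m f f-inj y
    with all? (λ j → any? (λ i → f j ≟ᴬ y i))
  ... | yes covered = contradiction covered (injection-not-covered n<m f f-inj y)
  ... | no ¬covered with j , missed ← ¬∀⟶∃¬ m _ (λ j → any? (λ i → f j ≟ᴬ y i)) ¬covered
    = j , λ i fj≡yi → missed (i , fj≡yi)

-- The coordinate i is only used to tell the constant words apart, which needs n ≥ 1.
constant-words : ∀ {m n q} → Fin n → m ≤ q → FinSubset n q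
constant-words {m} {n} {q} i m≤q = mkSubset (tabulate constant) (tabulate⁺ constant-injective)
  where
  constant : Fin m → Word n q
  constant j _ = inject≤ j m≤q
  constant-injective : Injective _≡_ _≡_ constant
  constant-injective {j} {k} e = inject≤-injective m≤q m≤q j k (cong-app e i)

size-constant-words : ∀ {m n q} (i : Fin n) (m≤q : m ≤ q) → size (constant-words {m} i m≤q) ≡ m
size-constant-words {m} i m≤q = length-tabulate {n = m} _

constant-words-skirting : ∀ {m n q} (i : Fin n) (m≤q : m ≤ q) → n < m →
                          IsSkirting (constant-words i m≤q)
constant-words-skirting {m} i m≤q n<m y
  with j , avoids ← ∃-outside-image _≟_ n<m (λ j → inject≤ j m≤q) (inject≤-injective m≤q m≤q _ _) y
  = (λ _ → inject≤ j m≤q) , ∈-tabulate⁺ j , avoids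

diagonal : ∀ {n q} → Fin q → List (Word n q) → Word n q
diagonal z xs i with toℕ i <? length xs
... | yes i<len = lookup xs (fromℕ< i<len) i
... | no _      = z

diagonal-lookup : ∀ {n q} (z : Fin q) (xs : List (Word n q)) (len≤n : length xs ≤ n)
                  (k : Fin (length xs)) →
                  diagonal z xs (inject≤ k len≤n) ≡ lookup xs k (inject≤ k len≤n)
diagonal-lookup z xs len≤n k with toℕ (inject≤ k len≤n) <? length xs
... | yes i<len = cong (λ k′ → lookup xs k′ (inject≤ k len≤n))
                    (toℕ-injective (trans (toℕ-fromℕ< i<len) (toℕ-inject≤ k len≤n)))
... | no  i≮len = contradiction (subst (_< length xs) (sym (toℕ-inject≤ k len≤n)) (toℕ<n k)) i≮len

diagonal-unskirted : ∀ {n q} (z : Fin q) (xs : List (Word n q)) → length xs ≤ n →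
                     ∀ {x} → x ∈ xs → ¬ Skirts x (diagonal z xs)
diagonal-unskirted z xs len≤n x∈xs skirts =
  skirts i (trans (cong-app (lookup-index x∈xs) i) (sym (diagonal-lookup z xs len≤n (index x∈xs))))
  where
  i : Fin _
  i = inject≤ (index x∈xs) len≤n

skirting⇒n<size : ∀ {n q} → Fin q → (S : FinSubset n q) → IsSkirting S → n < size S
skirting⇒n<size {n} z S skirting with n <? size S
... | yes n<size = n<size
... | no  n≮size with x , x∈S , skirts ← skirting (diagonal z (elems S))
  = contradiction skirts (diagonal-unskirted z (elems S) (≮⇒≥ n≮size) x∈S)

lemma2p2 : ∀ (n q : ℕ) → 1 ≤ n → 2 ≤ q → n < q → IsMinSkirtingSize n q (suc n)
lemma2p2 (suc n) (suc q) _ _ n<q =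
  ( constant-words zero n<q
  , constant-words-skirting zero n<q (n<1+n (suc n))
  , size-constant-words zero n<q ) ,
  skirting⇒n<size zero
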